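{- For $n\ge1$ let $\phi_n(x)=((n+1)x^2-3x-n)U_n(x)+(x+1)U_{n-1}(x)+x+1$. Then $\phi_n(x)=U^{\mathrm{e}}_n(x)Q_n(x)$, where for $k\ge1$ \[ Q_{2k}(x)=((2k+1)x^2-3x-2k)(U_k(x)-U_{k-1}(x))+(x+1)(U_{k-1}(x)-U_{k-2}(x)), \] and for $k\ge0$ \[ Q_{2k+1}(x)=((2k+2)x^2-3x-2k-1)(U_{k+1}(x)-U_{k-1}(x))+(x+1)(U_k(x)-U_{k-2}(x)). \]
   Context: $U_n$ is the Chebyshev polynomial of the second kind, $U_n(\cos\theta)=\sin((n+1)\theta)/\sin\theta$, extended to negative indices by the recurrence $U_{k+1}(x)=2xU_k(x)-U_{k-1}(x)$, i.e. $U_{ -1}(x)=0$, $U_{ -2}(x)=-1$. The partial Chebyshev polynomial $U^{\mathrm{e}}_n$ is determined by $U^{\mathrm{e}}_n(\cos\theta)=\frac{\sin((n+1)\theta/2)}{\sin(\theta/2)}$ for even $n$ and $U^{\mathrm{e}}_n(\cos\theta)=\frac{\sin((n+1)\theta/2)}{\sin\theta}$ for odd $n$. -}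

module Defs where

open import Level using (Level)
open import Data.Nat using (ℕ; zero; suc; ⌊_/2⌋) renaming (_+_ to _+ℕ_; _*_ to _*ℕ_)
open import Data.Bool using (Bool; true; false; if_then_else_)
open import Algebra.Bundles using (CommutativeRing)

isEven : ℕ → Bool
isEven zero = true
isEven (suc zero) = false
isEven (suc (suc n)) = isEven n

-- A polynomial identity over ℤ[x] is the same as an
-- identity holding for every element of every commutative ring.
module Cheb {c ℓ : Level} (R : CommutativeRing c ℓ) where
  open CommutativeRing R

  infixl 6 _−_
  _−_ : Carrier → Carrier → Carrier
  a − b = a + (- b)

  ι : ℕ → Carrier
  ι zero = 0#
  ι (suc n) = 1# + ι n

  -- Ush x m = U_{m-2}(x): U_{-2} = -1, U_{-1} = 0,
  -- U_{k+1} = 2x U_k - U_{k-1}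
  Ush : Carrier → ℕ → Carrier
  Ush x zero = - 1#
  Ush x (suc zero) = 0#
  Ush x (suc (suc m)) = (ι 2 * x) * Ush x (suc m) − Ush x m

  U : Carrier → ℕ → Carrier
  U x k = Ush x (k +ℕ 2)

  U-1 : Carrier → ℕ → Carrier
  U-1 x k = Ush x (k +ℕ 1)

  U-2 : Carrier → ℕ → Carrier
  U-2 x k = Ush x k

  -- partial Chebyshev polynomial:
  -- U^e_{2k} = U_k + U_{k-1}  (= sin((2k+1)θ/2)/sin(θ/2) at x = cos θ)
  -- U^e_{2k+1} = U_k          (= sin((k+1)θ)/sin θ at x = cos θ)
  Ue : Carrier → ℕ → Carrier
  Ue x n = if isEven n then U x ⌊ n /2⌋ + U-1 x ⌊ n /2⌋ else U x ⌊ n /2⌋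

  φ : Carrier → ℕ → Carrier
  φ x n = (((ι (n +ℕ 1) * (x * x)) − (ι 3 * x)) − ι n) * U x n
          + (x + 1#) * U-1 x n + x + 1#

  Qeven : Carrier → ℕ → Carrier
  Qeven x k = (((ι (2 *ℕ k +ℕ 1) * (x * x)) − (ι 3 * x)) − ι (2 *ℕ k)) * (U x k − U-1 x k)
              + (x + 1#) * (U-1 x k − U-2 x k)

  Qodd : Carrier → ℕ → Carrier
  Qodd x k = ((((ι (2 *ℕ k +ℕ 2) * (x * x)) − (ι 3 * x)) − ι (2 *ℕ k)) − 1#) * (U x (k +ℕ 1) − U-1 x k)
             + (x + 1#) * (U x k − U-2 x k)

  Q : Carrier → ℕ → Carrier
  Q x n = if isEven n then Qeven x ⌊ n /2⌋ else Qodd x ⌊ n /2⌋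

-- Write n = 2k or n = 2k + 1. The addition formula U_{p+q} = U_p U_q - U_{p-1} U_{q-1}
-- expresses U_n and U_{n-1} through U_{k+1}, U_k, U_{k-1}, U_{k-2}, and Cassini's identity
-- U_{k-1}^2 - U_k U_{k-2} = 1 turns the constant term x + 1 of φ_n into
-- (x + 1)(U_{k-1}^2 - U_k U_{k-2}). After these substitutions φ_n factors as
-- (U_k + U_{k-1}) Q_{2k}, resp. U_k Q_{2k+1}, by ring arithmetic alone.
module Submission where

open import Algebra.Bundles using (CommutativeRing)
open import Data.Bool.Base using (true; false)
open import Data.Integer.Base as ℤ using (ℤ; +_; -[1+_])
import Data.Integer.Properties as ℤ
open import Data.List.Base using (_∷_; [])
open import Data.Maybe.Base using (Maybe; map)
open import Data.Nat.Base as ℕ using (ℕ; zero; suc; _≤_; ⌊_/2⌋)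
import Data.Nat.Properties as ℕ
open import Data.Nat.Tactic.RingSolver using () renaming (solve to solveℕ)
import Data.Sign.Base as Sign
open import Relation.Binary.Consequences using (dec⇒weaklyDec)
open import Relation.Binary.PropositionalEquality.Core as ≡ using (_≡_; cong)

open import Defs

module IntegerRingSolver {r ℓ} (R : CommutativeRing r ℓ) where
  open CommutativeRing R
  open import Algebra.Properties.Semiring.Mult.TCOptimised semiring
    using (_×_; 1+×; ×-homo-+; ×1-homo-*)
  open import Algebra.Properties.Ring ring using (-‿distribˡ-*; -‿distribʳ-*)
  open import Algebra.Properties.AbelianGroup +-abelianGroup using (⁻¹-∙-comm)
  open import Algebra.Properties.Group +-group using (ε⁻¹≈ε; ⁻¹-involutive)
  open import Algebra.Properties.CommutativeSemigroup +-commutativeSemigroup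
    using (interchange)
  import Algebra.Solver.Ring.AlmostCommutativeRing as ACR
  open import Relation.Binary.Reasoning.Setoid setoid

  -- With the optimised _×_, fromℤ (+ 0) and fromℤ (+ 1) reduce to 0# and 1#,
  -- so the solver constants con (+ 0) and con (+ 1) denote them definitionally.
  fromℤ : ℤ → Carrier
  fromℤ (+ n)    = n × 1#
  fromℤ -[1+ n ] = - (suc n × 1#)

  fromℤ-⊖ : ∀ m n → fromℤ (m ℤ.⊖ n) ≈ m × 1# + - (n × 1#)
  fromℤ-⊖ m       zero    = sym (trans (+-congˡ ε⁻¹≈ε) (+-identityʳ _))
  fromℤ-⊖ zero    (suc n) = sym (+-identityˡ _)
  fromℤ-⊖ (suc m) (suc n) = begin
    fromℤ (suc m ℤ.⊖ suc n)             ≡⟨ cong fromℤ (ℤ.[1+m]⊖[1+n]≡m⊖n m n) ⟩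
    fromℤ (m ℤ.⊖ n)                     ≈⟨ fromℤ-⊖ m n ⟩
    m × 1# + - (n × 1#)                 ≈⟨ +-identityˡ _ ⟨
    0# + (m × 1# + - (n × 1#))          ≈⟨ +-congʳ (-‿inverseʳ 1#) ⟨
    (1# + - 1#) + (m × 1# + - (n × 1#)) ≈⟨ interchange _ _ _ _ ⟩
    (1# + m × 1#) + (- 1# + - (n × 1#)) ≈⟨ +-congˡ (⁻¹-∙-comm 1# (n × 1#)) ⟩
    (1# + m × 1#) + - (1# + n × 1#)     ≈⟨ +-cong (1+× m 1#) (-‿cong (1+× n 1#)) ⟨
    suc m × 1# + - (suc n × 1#)         ∎

  fromℤ-homo-negate : ∀ i → fromℤ (ℤ.- i) ≈ - fromℤ i
  fromℤ-homo-negate (+ zero)  = sym ε⁻¹≈ε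
  fromℤ-homo-negate (+ suc n) = refl
  fromℤ-homo-negate -[1+ n ]  = sym (⁻¹-involutive _)

  fromℤ-homo-+ : ∀ i j → fromℤ (i ℤ.+ j) ≈ fromℤ i + fromℤ j
  fromℤ-homo-+ (+ m)    (+ n)    = ×-homo-+ 1# m n
  fromℤ-homo-+ (+ m)    -[1+ n ] = fromℤ-⊖ m (suc n)
  fromℤ-homo-+ -[1+ m ] (+ n)    = trans (fromℤ-⊖ n (suc m)) (+-comm _ _)
  fromℤ-homo-+ -[1+ m ] -[1+ n ] = begin
    - (suc (suc (m ℕ.+ n)) × 1#)    ≡⟨ cong (λ k → - (suc k × 1#)) (ℕ.+-suc m n) ⟨
    - ((suc m ℕ.+ suc n) × 1#)      ≈⟨ -‿cong (×-homo-+ 1# (suc m) (suc n)) ⟩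
    - (suc m × 1# + suc n × 1#)     ≈⟨ ⁻¹-∙-comm _ _ ⟨
    - (suc m × 1#) + - (suc n × 1#) ∎

  fromℤ-+◃ : ∀ n → fromℤ (Sign.+ ℤ.◃ n) ≈ n × 1#
  fromℤ-+◃ n = reflexive (cong fromℤ (ℤ.+◃n≡+n n))

  fromℤ--◃ : ∀ n → fromℤ (Sign.- ℤ.◃ n) ≈ - (n × 1#)
  fromℤ--◃ n = trans (reflexive (cong fromℤ (ℤ.-◃n≡-n n))) (fromℤ-homo-negate (+ n))

  fromℤ-homo-* : ∀ i j → fromℤ (i ℤ.* j) ≈ fromℤ i * fromℤ j
  fromℤ-homo-* (+ m)    (+ n)    = trans (fromℤ-+◃ (m ℕ.* n)) (×1-homo-* m n)
  fromℤ-homo-* (+ m)    -[1+ n ] = begin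
    fromℤ (Sign.- ℤ.◃ (m ℕ.* suc n)) ≈⟨ fromℤ--◃ (m ℕ.* suc n) ⟩
    - ((m ℕ.* suc n) × 1#)           ≈⟨ -‿cong (×1-homo-* m (suc n)) ⟩
    - (m × 1# * suc n × 1#)          ≈⟨ -‿distribʳ-* _ _ ⟩
    m × 1# * - (suc n × 1#)          ∎
  fromℤ-homo-* -[1+ m ] (+ n)    = begin
    fromℤ (Sign.- ℤ.◃ (suc m ℕ.* n)) ≈⟨ fromℤ--◃ (suc m ℕ.* n) ⟩
    - ((suc m ℕ.* n) × 1#)           ≈⟨ -‿cong (×1-homo-* (suc m) n) ⟩
    - (suc m × 1# * n × 1#)          ≈⟨ -‿distribˡ-* _ _ ⟩
    - (suc m × 1#) * n × 1#          ∎
  fromℤ-homo-* -[1+ m ] -[1+ n ] = begin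
    fromℤ (Sign.+ ℤ.◃ (suc m ℕ.* suc n)) ≈⟨ fromℤ-+◃ (suc m ℕ.* suc n) ⟩
    (suc m ℕ.* suc n) × 1#               ≈⟨ ×1-homo-* (suc m) (suc n) ⟩
    a * b                                ≈⟨ ⁻¹-involutive _ ⟨
    - - (a * b)                          ≈⟨ -‿cong (-‿distribˡ-* a b) ⟩
    - (- a * b)                          ≈⟨ -‿distribʳ-* (- a) b ⟩
    - a * - b                            ∎
    where
    a b : Carrier
    a = suc m × 1#
    b = suc n × 1#

  homomorphism : ℤ.+-*-rawRing ACR.-Raw-AlmostCommutative⟶ ACR.fromCommutativeRing R
  homomorphism = record
    { ⟦_⟧    = fromℤ
    ; +-homo = fromℤ-homo-+
    ; *-homo = fromℤ-homo-*
    ; -‿homo = fromℤ-homo-negate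
    ; 0-homo = refl
    ; 1-homo = refl
    }

  fromℤ-≟ : ∀ i j → Maybe (fromℤ i ≈ fromℤ j)
  fromℤ-≟ i j = map (λ i≡j → reflexive (cong fromℤ i≡j)) (dec⇒weaklyDec ℤ._≟_ i j)

  open import Algebra.Solver.Ring ℤ.+-*-rawRing (ACR.fromCommutativeRing R) homomorphism fromℤ-≟
    public

data Parity (n : ℕ) : Set where
  even : isEven n ≡ true  → n ≡ 2 ℕ.* ⌊ n /2⌋         → Parity n
  odd  : isEven n ≡ false → n ≡ 2 ℕ.* ⌊ n /2⌋ ℕ.+ 1   → Parity n

parity : ∀ n → Parity n
parity zero          = even ≡.refl ≡.refl
parity (suc zero)    = odd ≡.refl ≡.refl
parity (suc (suc n)) with parity n
... | even isEven-n n≡2k   =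
  even isEven-n (≡.trans (cong (2 ℕ.+_) n≡2k) (≡.sym (ℕ.*-suc 2 ⌊ n /2⌋)))
... | odd  isOdd-n  n≡2k+1 =
  odd isOdd-n (≡.trans (cong (2 ℕ.+_) n≡2k+1) (≡.sym (cong (ℕ._+ 1) (ℕ.*-suc 2 ⌊ n /2⌋))))

module ChebyshevIdentities {r ℓ} (R : CommutativeRing r ℓ) (x : CommutativeRing.Carrier R) where
  open CommutativeRing R
  open Cheb R
  open IntegerRingSolver R using (solve; _:=_; _:+_; _:*_; _:-_; :-_; con)
  open import Algebra.Properties.AbelianGroup +-abelianGroup using (⁻¹-∙-comm)
  open import Relation.Binary.Reasoning.Setoid setoid

  −-cong : ∀ {a a′ b b′} → a ≈ a′ → b ≈ b′ → a − b ≈ a′ − b′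
  −-cong p q = +-cong p (-‿cong q)

  ι-+ : ∀ m n → ι (m ℕ.+ n) ≈ ι m + ι n
  ι-+ zero    n = sym (+-identityˡ _)
  ι-+ (suc m) n = trans (+-congˡ (ι-+ m n)) (sym (+-assoc _ _ _))

  -- U_{p+q-1} = U_p U_{q-1} - U_{p-1} U_{q-2}, recalling Ush x m = U_{m-2}.
  Ush-+ : ∀ p q →
    Ush x (suc (p ℕ.+ q)) ≈ Ush x (2 ℕ.+ p) * Ush x (suc q) − Ush x (suc p) * Ush x q
  Ush-+ zero q =
    solve 3 (λ c a b → a := (c :* con (+ 0) :- :- con (+ 1)) :* a :- con (+ 0) :* b)
      refl (ι 2 * x) (Ush x (suc q)) (Ush x q)
  Ush-+ (suc zero) q =
    solve 3 (λ c a b → c :* a :- b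
                     := (c :* (c :* con (+ 0) :- :- con (+ 1)) :- con (+ 0)) :* a
                        :- (c :* con (+ 0) :- :- con (+ 1)) :* b)
      refl (ι 2 * x) (Ush x (suc q)) (Ush x q)
  Ush-+ (suc (suc p)) q = begin
    c * Ush x (suc (suc (p ℕ.+ q))) − Ush x (suc (p ℕ.+ q))
      ≈⟨ −-cong (*-congˡ (Ush-+ (suc p) q)) (Ush-+ p q) ⟩
    c * (u₁ * a − u₀ * b) − (u₀ * a − u₋₁ * b)
      ≈⟨ solve 6 (λ c u₁ u₀ u₋₁ a b → c :* (u₁ :* a :- u₀ :* b) :- (u₀ :* a :- u₋₁ :* b)
                                    := (c :* u₁ :- u₀) :* a :- (c :* u₀ :- u₋₁) :* b)
           refl c u₁ u₀ u₋₁ a b ⟩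
    (c * u₁ − u₀) * a − (c * u₀ − u₋₁) * b
      ∎
    where
    c a b u₁ u₀ u₋₁ : Carrier
    c = ι 2 * x
    a = Ush x (suc q)
    b = Ush x q
    u₁ = Ush x (3 ℕ.+ p)
    u₀ = Ush x (2 ℕ.+ p)
    u₋₁ = Ush x (suc p)

  Ush-cassini : ∀ k → Ush x (suc k) * Ush x (suc k) − Ush x (2 ℕ.+ k) * Ush x k ≈ 1#
  Ush-cassini zero =
    solve 1 (λ c → con (+ 0) :* con (+ 0) :- (c :* con (+ 0) :- :- con (+ 1)) :* :- con (+ 1)
                 := con (+ 1))
      refl (ι 2 * x)
  Ush-cassini (suc k) = begin
    (c * a − b) * (c * a − b) − (c * (c * a − b) − a) * a
      ≈⟨ solve 3 (λ c a b → (c :* a :- b) :* (c :* a :- b) :- (c :* (c :* a :- b) :- a) :* a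
                          := a :* a :- (c :* a :- b) :* b)
           refl c a b ⟩
    a * a − (c * a − b) * b
      ≈⟨ Ush-cassini k ⟩
    1#  ∎
    where
    c a b : Carrier
    c = ι 2 * x
    a = Ush x (suc k)
    b = Ush x k

  U≡Ush : ∀ k → U x k ≡ Ush x (2 ℕ.+ k)
  U≡Ush k = cong (Ush x) (ℕ.+-comm k 2)

  U-1≡Ush : ∀ k → U-1 x k ≡ Ush x (suc k)
  U-1≡Ush k = cong (Ush x) (ℕ.+-comm k 1)

  U-cassini : ∀ k → U-1 x k * U-1 x k − U x k * U-2 x k ≈ 1#
  U-cassini k rewrite U≡Ush k | U-1≡Ush k = Ush-cassini k

  U-double : ∀ k → U x (2 ℕ.* k) ≈ U x k * U x k − U-1 x k * U-1 x k
  U-double k rewrite U≡Ush k | U-1≡Ush k =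
    trans (reflexive (cong (Ush x) index)) (Ush-+ k (suc k))
    where
    index : 2 ℕ.* k ℕ.+ 2 ≡ suc (k ℕ.+ suc k)
    index = solveℕ (k ∷ [])

  U-1-double : ∀ k → U-1 x (2 ℕ.* k) ≈ U x k * U-1 x k − U-1 x k * U-2 x k
  U-1-double k rewrite U≡Ush k | U-1≡Ush k =
    trans (reflexive (cong (Ush x) index)) (Ush-+ k k)
    where
    index : 2 ℕ.* k ℕ.+ 1 ≡ suc (k ℕ.+ k)
    index = solveℕ (k ∷ [])

  U-double+1 : ∀ k → U x (2 ℕ.* k ℕ.+ 1) ≈ U x k * U x (k ℕ.+ 1) − U-1 x k * U x k
  U-double+1 k rewrite U≡Ush k | U-1≡Ush k | U≡Ush (k ℕ.+ 1) | ℕ.+-comm k 1 =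
    trans (reflexive (cong (Ush x) index)) (Ush-+ k (2 ℕ.+ k))
    where
    index : 2 ℕ.* k ℕ.+ 1 ℕ.+ 2 ≡ suc (k ℕ.+ (2 ℕ.+ k))
    index = solveℕ (k ∷ [])

  U-1-double+1 : ∀ k → U-1 x (2 ℕ.* k ℕ.+ 1) ≈ U x k * U x k − U-1 x k * U-1 x k
  U-1-double+1 k = trans (reflexive (cong (Ush x) (ℕ.+-assoc (2 ℕ.* k) 1 1))) (U-double k)

  ι-odd : ∀ k → ι (2 ℕ.* k ℕ.+ 1) ≈ ι (2 ℕ.* k) + 1#
  ι-odd k = trans (ι-+ (2 ℕ.* k) 1) (+-congˡ (+-identityʳ 1#))

  φ-regroup : ∀ a p q → a * p + (x + 1#) * q + x + 1# ≈ a * p + (x + 1#) * (q + 1#)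
  φ-regroup =
    solve 4 (λ y a p q → a :* p :+ (y :+ con (+ 1)) :* q :+ y :+ con (+ 1)
                      := a :* p :+ (y :+ con (+ 1)) :* (q :+ con (+ 1)))
      refl x

  even-factorisation : ∀ a b u v w →
    a * (u * u − v * v) + b * ((u * v − v * w) + (v * v − u * w))
      ≈ (u + v) * (a * (u − v) + b * (v − w))
  even-factorisation =
    solve 5 (λ a b u v w → a :* (u :* u :- v :* v)
                           :+ b :* ((u :* v :- v :* w) :+ (v :* v :- u :* w))
                        := (u :+ v) :* (a :* (u :- v) :+ b :* (v :- w)))
      refl

  odd-factorisation : ∀ a b u₊ u v w →
    a * (u * u₊ − v * u) + b * ((u * u − v * v) + (v * v − u * w))
      ≈ u * (a * (u₊ − v) + b * (u − w))
  odd-factorisation =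
    solve 6 (λ a b u₊ u v w → a :* (u :* u₊ :- v :* u)
                              :+ b :* ((u :* u :- v :* v) :+ (v :* v :- u :* w))
                           := u :* (a :* (u₊ :- v) :+ b :* (u :- w)))
      refl

  φ-even : ∀ k → φ x (2 ℕ.* k) ≈ (U x k + U-1 x k) * Qeven x k
  φ-even k = begin
    φ x (2 ℕ.* k)
      ≈⟨ φ-regroup a (U x (2 ℕ.* k)) (U-1 x (2 ℕ.* k)) ⟩
    a * U x (2 ℕ.* k) + b * (U-1 x (2 ℕ.* k) + 1#)
      ≈⟨ +-cong (*-congˡ (U-double k)) (*-congˡ (+-cong (U-1-double k) (sym (U-cassini k)))) ⟩
    a * (u * u − v * v) + b * ((u * v − v * w) + (v * v − u * w))
      ≈⟨ even-factorisation a b u v w ⟩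
    (u + v) * (a * (u − v) + b * (v − w))
      ∎
    where
    a b u v w : Carrier
    a = ((ι (2 ℕ.* k ℕ.+ 1) * (x * x)) − (ι 3 * x)) − ι (2 ℕ.* k)
    b = x + 1#
    u = U x k
    v = U-1 x k
    w = U-2 x k

  φ-odd : ∀ k → φ x (2 ℕ.* k ℕ.+ 1) ≈ U x k * Qodd x k
  φ-odd k = begin
    φ x (2 ℕ.* k ℕ.+ 1)
      ≈⟨ φ-regroup a′ (U x (2 ℕ.* k ℕ.+ 1)) (U-1 x (2 ℕ.* k ℕ.+ 1)) ⟩
    a′ * U x (2 ℕ.* k ℕ.+ 1) + b * (U-1 x (2 ℕ.* k ℕ.+ 1) + 1#)
      ≈⟨ +-cong (*-cong a′≈a (U-double+1 k))
                (*-congˡ (+-cong (U-1-double+1 k) (sym (U-cassini k)))) ⟩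
    a * (u * u₊ − v * u) + b * ((u * u − v * v) + (v * v − u * w))
      ≈⟨ odd-factorisation a b u₊ u v w ⟩
    u * (a * (u₊ − v) + b * (u − w))
      ∎
    where
    s a′ a b u₊ u v w : Carrier
    s = (ι (2 ℕ.* k ℕ.+ 2) * (x * x)) − (ι 3 * x)
    a′ = ((ι (2 ℕ.* k ℕ.+ 1 ℕ.+ 1) * (x * x)) − (ι 3 * x)) − ι (2 ℕ.* k ℕ.+ 1)
    a = (s − ι (2 ℕ.* k)) − 1#
    b = x + 1#
    u₊ = U x (k ℕ.+ 1)
    u = U x k
    v = U-1 x k
    w = U-2 x k
    a′≈a : a′ ≈ a
    a′≈a = begin
      a′
        ≈⟨ −-cong (+-congʳ (*-congʳ (reflexive (cong ι (ℕ.+-assoc (2 ℕ.* k) 1 1))))) (ι-odd k) ⟩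
      s − (ι (2 ℕ.* k) + 1#)     ≈⟨ +-congˡ (⁻¹-∙-comm _ _) ⟨
      s + (- ι (2 ℕ.* k) + - 1#) ≈⟨ +-assoc _ _ _ ⟨
      a                          ∎

  φ≈Ue*Q : ∀ n → φ x n ≈ Ue x n * Q x n
  φ≈Ue*Q n with parity n
  ... | even isEven-n n≡2k   rewrite isEven-n =
    trans (reflexive (cong (φ x) n≡2k)) (φ-even ⌊ n /2⌋)
  ... | odd  isOdd-n  n≡2k+1 rewrite isOdd-n  =
    trans (reflexive (cong (φ x) n≡2k+1)) (φ-odd ⌊ n /2⌋)

theoremB4 : ∀ {c ℓ} (R : CommutativeRing c ℓ) (n : ℕ) → 1 ≤ n → (x : CommutativeRing.Carrier R) →
    CommutativeRing._≈_ R (Cheb.φ R x n) (CommutativeRing._*_ R (Cheb.Ue R x n) (Cheb.Q R x n))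
theoremB4 R n _ x = ChebyshevIdentities.φ≈Ue*Q R x n
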